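{- If $G$ is a finite simple graph with $\iota(G)>\frac{\omega(G)}{2}$, then $\chi(G)\le\frac{\omega(G)+\Delta(G)+1}{2}$.
   Context: $\chi(G)$, $\omega(G)$, $\Delta(G)$ denote the chromatic number, clique number and maximum degree of $G$. An optimal coloring is a proper coloring with $\chi(G)$ color classes. The stinginess $\iota(G)$ is the maximum number of singleton color classes (color classes with exactly one vertex) appearing in an optimal coloring of $G$. -}

module Defs where

open import Data.Nat using (ℕ; zero; suc; _+_; _≤_; _<_)
open import Data.Nat as ℕ using (_⊔_)
open import Data.Fin using (Fin)
open import Data.Bool using (Bool; true; false; if_then_else_)
open import Data.List using (List; length; filter; map; foldr)
open import Data.List.Base using (allFin)
open import Data.Product using (Σ; ∃; _×_; _,_)
open import Relation.Binary.PropositionalEquality using (_≡_; _≢_)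
open import Relation.Nullary using (¬_; Dec)
open import Relation.Nullary.Decidable using (⌊_⌋)
open import Data.Fin using (_≟_)
open import Function.Definitions using (Injective)

record Graph (n : ℕ) : Set where
  field
    adj   : Fin n → Fin n → Bool
    sym   : ∀ u v → adj u v ≡ adj v u
    irrefl : ∀ v → adj v v ≡ false
open Graph public

module _ {n : ℕ} (G : Graph n) where

  Adj : Fin n → Fin n → Set
  Adj u v = adj G u v ≡ true

  degree : Fin n → ℕ
  degree v = length (filter (λ u → adj G v u Data.Bool.≟ true) (allFin n))

  maxDegree : ℕ
  maxDegree = foldr (λ v m → degree v ⊔ m) 0 (allFin n)

  Proper : (k : ℕ) → (Fin n → Fin k) → Set
  Proper k c = ∀ u v → Adj u v → c u ≢ c v

  Colorable : ℕ → Set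
  Colorable k = Σ (Fin n → Fin k) (Proper k)

  IsChromaticNumber : ℕ → Set
  IsChromaticNumber k = Colorable k × (∀ j → j < k → ¬ Colorable j)

  Clique : (w : ℕ) → (Fin w → Fin n) → Set
  Clique w f = Injective _≡_ _≡_ f × (∀ i j → i ≢ j → Adj (f i) (f j))

  HasClique : ℕ → Set
  HasClique w = Σ (Fin w → Fin n) (Clique w)

  IsCliqueNumber : ℕ → Set
  IsCliqueNumber w = HasClique w × (∀ m → HasClique m → m ≤ w)

  classSize : {k : ℕ} → (Fin k → Fin n → Bool) → Fin k → ℕ
  classSize f i = length (filter (λ v → f i v Data.Bool.≟ true) (allFin n))

  singletons : (k : ℕ) → (Fin n → Fin k) → ℕ
  singletons k c =
    length (filter (λ i → classSize (λ j v → ⌊ c v ≟ j ⌋) i ℕ.≟ 1) (allFin k))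

  IsStinginess : ℕ → Set
  IsStinginess s =
    Σ ℕ λ χ → IsChromaticNumber χ ×
      ((Σ (Fin n → Fin χ) λ c → Proper χ c × singletons χ c ≡ s) ×
       (∀ (c : Fin n → Fin χ) → Proper χ c → singletons χ c ≤ s))

-- Fix an optimal colouring with ι singleton classes. Optimality (no colour class can be emptied by
-- recolouring) forces: singleton vertices are pairwise adjacent; a singleton v sees every other colour;
-- and if u is the only neighbour of v of its colour, exchanging the colours of v and u gives another
-- optimal colouring in which u is a singleton, so u is adjacent to every other singleton, and lone
-- neighbours of distinct singletons with distinct colours are adjacent.
-- Call a colour light at v if it is not a singleton colour and occurs exactly once around v; every
-- colour is light, a singleton colour, or occurs twice around v. If some singleton v has at most ω − ι
-- light colours, its closed neighbourhood holds one vertex of each colour and a second vertex of each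
-- colour occurring twice, whence 2χ ≤ ω + deg v + 1. Otherwise every singleton has at least
-- m = ω + 1 − ι ≤ ι light colours; picking distinct light colours at m of the singletons, the lone
-- neighbours in these colours together with all ι singletons form a clique on ω + 1 vertices.

module Submission where

open import Data.Bool as Bool using (true)
open import Data.Bool.Properties using (T-≡)
open import Data.Empty using (⊥-elim)
open import Data.Fin using (Fin; zero; suc; _≟_; splitAt; join; inject≤; punchOut)
open import Data.Fin.Properties
  using (any?; all?; injective⇒≤; splitAt-join; +↔⊎; inject≤-injective; punchOut-injective)
open import Data.List using (List; []; _∷_; length; filter; allFin; lookup; foldr)
open import Data.List.Membership.Propositional using (_∈_)
open import Data.List.Membership.Propositional.Properties using (∈-filter⁺; ∈-filter⁻; ∈-allFin; ∈-lookup)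
open import Data.List.Relation.Unary.All as All using ()
open import Data.List.Relation.Unary.Any as Any using (here; there)
open import Data.List.Relation.Unary.Any.Properties using (lookup-index)
open import Data.List.Relation.Unary.Unique.Propositional using (Unique; _∷_)
open import Data.List.Relation.Unary.Unique.Propositional.Properties using (allFin⁺; filter⁺)
open import Data.Nat as ℕ using (ℕ; zero; suc; _+_; _*_; _∸_; _≤_; _<_; _≤?_; _⊔_)
open import Data.Nat.Properties
  using (≤-refl; ≤-trans; <⇒≤; <⇒≱; ≰⇒>; <-cmp; m≤m⊔n; m≤n⊔m; +-identityʳ; +-assoc; +-comm;
         +-monoʳ-≤; +-monoˡ-≤; m≤n+m∸n; m≤n+o⇒m∸n≤o; module ≤-Reasoning)
open import Data.Product using (∃; _×_; _,_; proj₁; proj₂)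
open import Data.Sum using (_⊎_; inj₁; inj₂; [_,_]′; map₂)
open import Data.Unit using (tt)
import Data.Vec.Functional as Vector
open import Data.Vec.Functional using (updateAt)
open import Data.Vec.Functional.Properties using (updateAt-updates; updateAt-minimal)
open import Function using (_∘_; _∘′_; id; const)
open import Function.Bundles using (Injection; Equivalence)
import Function.Construct.Composition as Compose
open import Function.Definitions using (Injective)
open import Function.Properties.Inverse using (↔⇒↣)
open import Relation.Binary.Definitions using (tri<; tri≈; tri>)
open import Relation.Binary.PropositionalEquality
  using (_≡_; _≢_; refl; sym; trans; cong; subst; subst₂; module ≡-Reasoning)
open import Relation.Nullary using (¬_; Dec; yes; no; ¬?)
open import Relation.Nullary.Decidable using (⌊_⌋; _×-dec_; _⊎-dec_; toSum; toWitness; fromWitness)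
open import Relation.Unary using (Pred; Decidable; U)
open import Relation.Unary.Properties using (U?; ∁?)

open import Defs renaming (sym to adj-sym)

[,]-injective : ∀ {A B C : Set} {f : A → C} {g : B → C} → Injective _≡_ _≡_ f → Injective _≡_ _≡_ g →
                (∀ a b → f a ≢ g b) → Injective _≡_ _≡_ [ f , g ]′
[,]-injective f-inj g-inj disjoint {inj₁ a} {inj₁ a′} eq = cong inj₁ (f-inj eq)
[,]-injective f-inj g-inj disjoint {inj₁ a} {inj₂ b}  eq = ⊥-elim (disjoint a b eq)
[,]-injective f-inj g-inj disjoint {inj₂ b} {inj₁ a}  eq = ⊥-elim (disjoint a b (sym eq))
[,]-injective f-inj g-inj disjoint {inj₂ b} {inj₂ b′} eq = cong inj₂ (g-inj eq)

splitAt-injective : ∀ m {n} → Injective _≡_ _≡_ (splitAt m {n})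
splitAt-injective m = Injection.injective (↔⇒↣ +↔⊎)

lookup-injective : ∀ {a} {A : Set a} {xs : List A} → Unique xs → Injective _≡_ _≡_ (lookup xs)
lookup-injective (x∉xs ∷ _)  {zero}  {zero}  _  = refl
lookup-injective (x∉xs ∷ _)  {zero}  {suc j} eq = ⊥-elim (All.lookup x∉xs (∈-lookup j) eq)
lookup-injective (x∉xs ∷ _)  {suc i} {zero}  eq = ⊥-elim (All.lookup x∉xs (∈-lookup i) (sym eq))
lookup-injective (_ ∷ uniq) {suc i} {suc j} eq = cong suc (lookup-injective uniq eq)

module _ {m p} {P : Pred (Fin m) p} (P? : Decidable P) where

  count : ℕ
  count = length (filter P? (allFin m))

  enumerate : Fin count → Fin m
  enumerate = lookup (filter P? (allFin m))

  enumerate-sound : ∀ i → P (enumerate i)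
  enumerate-sound i = proj₂ (∈-filter⁻ P? {xs = allFin m} (∈-lookup i))

  enumerate-complete : ∀ {x} → P x → ∃ λ i → enumerate i ≡ x
  enumerate-complete {x} px = Any.index x∈ , sym (lookup-index x∈)
    where x∈ = ∈-filter⁺ P? (∈-allFin x) px

  enumerate-injective : Injective _≡_ _≡_ enumerate
  enumerate-injective = lookup-injective (filter⁺ P? (allFin⁺ m))

  injection⇒≤count : ∀ {a} (f : Fin a → Fin m) → Injective _≡_ _≡_ f → (∀ i → P (f i)) → a ≤ count
  injection⇒≤count {a} f f-injective Pf = injective⇒≤ {f = index} index-injective
    where
      index : Fin a → Fin count
      index i = proj₁ (enumerate-complete (Pf i))
      index-injective : Injective _≡_ _≡_ index
      index-injective {i} {j} eq = f-injective (begin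
        f i                 ≡⟨ proj₂ (enumerate-complete (Pf i)) ⟨
        enumerate (index i) ≡⟨ cong enumerate eq ⟩
        enumerate (index j) ≡⟨ proj₂ (enumerate-complete (Pf j)) ⟩
        f j                 ∎)
        where open ≡-Reasoning

  cover⇒count≤ : ∀ {a} (f : Fin a → Fin m) → (∀ {x} → P x → ∃ λ i → f i ≡ x) → count ≤ a
  cover⇒count≤ {a} f cover = injective⇒≤ {f = preimage} preimage-injective
    where
      preimage : Fin count → Fin a
      preimage e = proj₁ (cover (enumerate-sound e))
      preimage-injective : Injective _≡_ _≡_ preimage
      preimage-injective {d} {e} eq = enumerate-injective (begin
        enumerate d        ≡⟨ proj₂ (cover (enumerate-sound d)) ⟨
        f (preimage d)     ≡⟨ cong f eq ⟩
        f (preimage e)     ≡⟨ proj₂ (cover (enumerate-sound e)) ⟩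
        enumerate e        ∎)
        where open ≡-Reasoning

count-⊎ : ∀ {m p q r} {P : Pred (Fin m) p} {Q : Pred (Fin m) q} {R : Pred (Fin m) r}
          (P? : Decidable P) (Q? : Decidable Q) (R? : Decidable R) →
          (∀ {x} → P x → Q x ⊎ R x) → count P? ≤ count Q? + count R?
count-⊎ {m} {P = P} P? Q? R? P⊆Q∪R = cover⇒count≤ P? (both ∘ splitAt (count Q?)) cover
  where
    both : Fin (count Q?) ⊎ Fin (count R?) → Fin m
    both = [ enumerate Q? , enumerate R? ]′
    cover : ∀ {x} → P x → ∃ λ i → both (splitAt (count Q?) i) ≡ x
    cover px with P⊆Q∪R px
    ... | inj₁ qx = let i , eq = enumerate-complete Q? qx in
      join _ _ (inj₁ i) , trans (cong both (splitAt-join _ _ (inj₁ i))) eq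
    ... | inj₂ rx = let i , eq = enumerate-complete R? rx in
      join _ _ (inj₂ i) , trans (cong both (splitAt-join _ _ (inj₂ i))) eq

distinctRepresentatives : ∀ {k ℓ} j (L : Fin j → Pred (Fin k) ℓ) (L? : ∀ i → Decidable (L i)) →
                          (∀ i → j ≤ count (L? i)) →
                          ∃ λ σ → Injective _≡_ _≡_ σ × (∀ i → L i (σ i))
distinctRepresentatives zero    L L? large = (λ ()) , (λ { {()} }) , (λ ())
distinctRepresentatives (suc j) L L? large
  with distinctRepresentatives j (L ∘ suc) (L? ∘ suc) (λ i → <⇒≤ (large (suc i)))
... | σ , σ-injective , σ∈L with any? (λ x → L? zero x ×-dec all? (λ i → ¬? (σ i ≟ x)))
...   | yes (x , x∈L , fresh) = x Vector.∷ σ , injective , λ { zero → x∈L ; (suc i) → σ∈L i }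
  where
    injective : Injective _≡_ _≡_ (x Vector.∷ σ)
    injective {zero}  {zero}  _  = refl
    injective {zero}  {suc i} eq = ⊥-elim (fresh i (sym eq))
    injective {suc i} {zero}  eq = ⊥-elim (fresh i eq)
    injective {suc i} {suc i′} eq = cong suc (σ-injective eq)
...   | no none = ⊥-elim (<⇒≱ (large zero) (cover⇒count≤ (L? zero) σ covered))
  where
    covered : ∀ {x} → L zero x → ∃ λ i → σ i ≡ x
    covered {x} x∈L with any? (λ i → σ i ≟ x)
    ... | yes hit  = hit
    ... | no miss = ⊥-elim (none (x , x∈L , λ i σi≡x → miss (i , σi≡x)))

module _ {n} (G : Graph n) where

  Adj-sym : ∀ {u v} → Adj G u v → Adj G v u
  Adj-sym {u} {v} uv = trans (adj-sym G v u) uv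

  Adj? : ∀ u v → Dec (Adj G u v)
  Adj? u v = adj G u v Bool.≟ true

  Adj⇒≢ : ∀ {u v} → Adj G u v → u ≢ v
  Adj⇒≢ {u} uu refl with trans (sym uu) (irrefl G u)
  ... | ()

  unusedColour⇒colourable : ∀ {k c} → Proper G k c → ∀ z → (∀ x → c x ≢ z) → ∃ λ j → j < k × Colorable G j
  unusedColour⇒colourable {suc k} {c} proper z unused = k , ≤-refl , squeeze , squeeze-proper
    where
      squeeze : Fin n → Fin k
      squeeze x = punchOut (unused x ∘′ sym)
      squeeze-proper : Proper G k squeeze
      squeeze-proper x y xy = proper x y xy ∘′ punchOut-injective (unused x ∘′ sym) (unused y ∘′ sym)

  pairwiseAdjacent⇒clique : ∀ {w} (f : Fin w → Fin n) → (∀ i j → i ≢ j → Adj G (f i) (f j)) → HasClique G w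
  pairwiseAdjacent⇒clique f adjacent = f , injective , adjacent
    where
      injective : Injective _≡_ _≡_ f
      injective {i} {j} eq with i ≟ j
      ... | yes i≡j = i≡j
      ... | no i≢j  = ⊥-elim (Adj⇒≢ (adjacent i j i≢j) eq)

  degree≤maxDegree : ∀ v → degree G v ≤ maxDegree G
  degree≤maxDegree v = go (allFin n) (∈-allFin v)
    where
      go : ∀ xs → v ∈ xs → degree G v ≤ foldr (λ u d → degree G u ⊔ d) 0 xs
      go (_ ∷ xs) (here refl) = m≤m⊔n _ _
      go (_ ∷ xs) (there v∈xs) = ≤-trans (go xs v∈xs) (m≤n⊔m _ _)

  chromaticNumber-unique : ∀ {χ χ′} → IsChromaticNumber G χ → IsChromaticNumber G χ′ → χ ≡ χ′
  chromaticNumber-unique {χ} {χ′} (colourable , optimal) (colourable′ , optimal′) with <-cmp χ χ′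
  ... | tri< χ<χ′ _ _ = ⊥-elim (optimal′ χ χ<χ′ colourable)
  ... | tri≈ _ χ≡χ′ _ = χ≡χ′
  ... | tri> _ _ χ′<χ = ⊥-elim (optimal χ′ χ′<χ colourable′)

module Recolouring {n} (G : Graph n) {k : ℕ} where

  Singleton : (Fin n → Fin k) → Fin n → Set
  Singleton c x = ∀ y → c y ≡ c x → y ≡ x

  LoneNeighbour : (Fin n → Fin k) → Fin n → Fin n → Set
  LoneNeighbour c v u = Adj G v u × (∀ w → Adj G v w → c w ≡ c u → w ≡ u)

  recolour : (Fin n → Fin k) → Fin n → Fin k → Fin n → Fin k
  recolour c x t = updateAt c x (const t)

  swap : (Fin n → Fin k) → Fin n → Fin n → Fin n → Fin k
  swap c v u = recolour (recolour c v (c u)) u (c v)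

  module _ {c : Fin n → Fin k} {x : Fin n} {t : Fin k} where

    recolour-at : recolour c x t x ≡ t
    recolour-at = updateAt-updates x c

    recolour-away : ∀ {y} → y ≢ x → recolour c x t y ≡ c y
    recolour-away {y} y≢x = updateAt-minimal y x c y≢x

    recolour-proper : Proper G k c → (∀ y → Adj G x y → c y ≢ t) → Proper G k (recolour c x t)
    recolour-proper proper free = proper′
      where
        at-x : ∀ z → Adj G x z → recolour c x t x ≢ recolour c x t z
        at-x z xz eq = free z xz (begin
          c z                ≡⟨ recolour-away (Adj⇒≢ G xz ∘′ sym) ⟨
          recolour c x t z   ≡⟨ eq ⟨
          recolour c x t x   ≡⟨ recolour-at ⟩
          t                  ∎)
          where open ≡-Reasoning
        proper′ : Proper G k (recolour c x t)
        proper′ y z yz with y ≟ x | z ≟ x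
        ... | yes refl | _        = at-x z yz
        ... | no _     | yes refl = at-x y (Adj-sym G yz) ∘′ sym
        ... | no y≢x   | no z≢x   = λ eq → proper y z yz
          (trans (sym (recolour-away y≢x)) (trans eq (recolour-away z≢x)))

  recolour-misses : ∀ {c x t} → Singleton c x → t ≢ c x → ∀ y → recolour c x t y ≢ c x
  recolour-misses {c} {x} {t} single t≢cx y with y ≟ x
  ... | yes refl = t≢cx ∘′ trans (sym recolour-at)
  ... | no y≢x   = y≢x ∘′ single y ∘′ trans (sym (recolour-away y≢x))

  data SwapView (c : Fin n → Fin k) (v u : Fin n) : Fin n → Set where
    at-v  : swap c v u v ≡ c u → SwapView c v u v
    at-u  : swap c v u u ≡ c v → SwapView c v u u
    other : ∀ {y} → y ≢ v → y ≢ u → swap c v u y ≡ c y → SwapView c v u y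

  swapView : ∀ c {v u} → v ≢ u → ∀ y → SwapView c v u y
  swapView c {v} {u} v≢u y with y ≟ v | y ≟ u
  ... | yes refl | _        = at-v (trans (recolour-away v≢u) recolour-at)
  ... | no _     | yes refl = at-u recolour-at
  ... | no y≢v   | no y≢u   = other y≢v y≢u (trans (recolour-away y≢u) (recolour-away y≢v))

  module _ {c : Fin n → Fin k} {v u : Fin n} (v-single : Singleton c v) (lone : LoneNeighbour c v u) where

    private
      v≢u : v ≢ u
      v≢u = Adj⇒≢ G (proj₁ lone)

    swap-proper : Proper G k c → Proper G k (swap c v u)
    swap-proper proper x y xy eq with swapView c v≢u x | swapView c v≢u y
    ... | at-v _        | at-v _        = Adj⇒≢ G xy refl
    ... | at-u _        | at-u _        = Adj⇒≢ G xy refl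
    ... | at-v e        | at-u e′       = proper u v (Adj-sym G xy) (subst₂ _≡_ e e′ eq)
    ... | at-u e        | at-v e′       = proper u v xy (subst₂ _≡_ e′ e (sym eq))
    ... | other _ _ e   | other _ _ e′  = proper x y xy (subst₂ _≡_ e e′ eq)
    ... | at-v e        | other _ y≢u e′ = y≢u (proj₂ lone y xy (sym (subst₂ _≡_ e e′ eq)))
    ... | other _ x≢u e | at-v e′       = x≢u (proj₂ lone x (Adj-sym G xy) (subst₂ _≡_ e e′ eq))
    ... | at-u e        | other y≢v _ e′ = y≢v (v-single y (sym (subst₂ _≡_ e e′ eq)))
    ... | other x≢v _ e | at-u e′       = x≢v (v-single x (subst₂ _≡_ e e′ eq))

    swap-singleton-at-u : Singleton (swap c v u) u
    swap-singleton-at-u y eq with swapView c v≢u y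
    ... | at-v e        = ⊥-elim (v≢u (sym (v-single u (subst₂ _≡_ e recolour-at eq))))
    ... | at-u _        = refl
    ... | other y≢v _ e = ⊥-elim (y≢v (v-single y (subst₂ _≡_ e recolour-at eq)))

    swap-singleton : ∀ {w} → Singleton c w → v ≢ w → u ≢ w → Singleton (swap c v u) w
    swap-singleton {w} w-single v≢w u≢w y eq with swapView c v≢u w | swapView c v≢u y
    ... | at-v _      | _           = ⊥-elim (v≢w refl)
    ... | at-u _      | _           = ⊥-elim (u≢w refl)
    ... | other _ _ e | at-v e′     = ⊥-elim (u≢w (w-single u (subst₂ _≡_ e′ e eq)))
    ... | other _ _ e | at-u e′     = ⊥-elim (v≢w (w-single v (subst₂ _≡_ e′ e eq)))
    ... | other _ _ e | other _ _ e′ = w-single y (subst₂ _≡_ e′ e eq)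

    swap-loneNeighbour : ∀ {w u′} → LoneNeighbour c w u′ → c u ≢ c u′ → u′ ≢ v →
                         LoneNeighbour (swap c v u) w u′
    swap-loneNeighbour {w} {u′} (wu′ , lone′) cu≢cu′ u′≢v = wu′ , lone″
      where
        lone″ : ∀ y → Adj G w y → swap c v u y ≡ swap c v u u′ → y ≡ u′
        lone″ y wy eq with swapView c v≢u u′ | swapView c v≢u y
        ... | at-v _      | _           = ⊥-elim (u′≢v refl)
        ... | at-u _      | _           = ⊥-elim (cu≢cu′ refl)
        ... | other _ _ e | at-v e′     = ⊥-elim (cu≢cu′ (subst₂ _≡_ e′ e eq))
        ... | other _ _ e | at-u e′     = ⊥-elim (u′≢v (v-single u′ (sym (subst₂ _≡_ e′ e eq))))
        ... | other _ _ e | other _ _ e′ = lone′ y wy (subst₂ _≡_ e′ e eq)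

module Optimal {n} (G : Graph n) {k} (optimal : ∀ j → j < k → ¬ Colorable G j) where

  open Recolouring G

  proper-uses-every-colour : ∀ {c} → Proper G k c → ∀ z → ¬ (∀ x → c x ≢ z)
  proper-uses-every-colour proper z unused =
    let j , j<k , colourable = unusedColour⇒colourable G proper z unused in optimal j j<k colourable

  singleton-sees-every-colour : ∀ {c v} → Proper G k c → Singleton c v →
                                ∀ j → j ≢ c v → ∃ λ u → Adj G v u × c u ≡ j
  singleton-sees-every-colour {c} {v} proper v-single j j≢cv
    with any? (λ u → Adj? G v u ×-dec c u ≟ j)
  ... | yes found  = found
  ... | no missing = ⊥-elim (proper-uses-every-colour
    (recolour-proper {x = v} proper (λ u vu cu≡j → missing (u , vu , cu≡j)))
    (c v) (recolour-misses v-single j≢cv))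

  singletons-adjacent : ∀ {c v w} → Proper G k c → Singleton c v → Singleton c w → v ≢ w → Adj G v w
  singletons-adjacent {c} {v} {w} proper v-single w-single v≢w with Adj? G v w
  ... | yes vw = vw
  ... | no ¬vw = ⊥-elim (proper-uses-every-colour
    (recolour-proper {x = w} proper free) (c w) (recolour-misses w-single (v≢w ∘′ w-single v)))
    where
      free : ∀ y → Adj G w y → c y ≢ c v
      free y wy cy≡cv with v-single y cy≡cv
      ... | refl = ¬vw (Adj-sym G wy)

  loneNeighbour-adjacent : ∀ {c v w u} → Proper G k c → Singleton c v → Singleton c w →
                           LoneNeighbour c v u → u ≢ w → Adj G u w
  loneNeighbour-adjacent {v = v} {w} proper v-single w-single lone u≢w with v ≟ w
  ... | yes refl = Adj-sym G (proj₁ lone)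
  ... | no v≢w   = singletons-adjacent (swap-proper v-single lone proper)
    (swap-singleton-at-u v-single lone) (swap-singleton v-single lone w-single v≢w u≢w) u≢w

  loneNeighbours-adjacent : ∀ {c v w u u′} → Proper G k c → Singleton c v → Singleton c w → v ≢ w →
                            LoneNeighbour c v u → LoneNeighbour c w u′ → c u ≢ c u′ →
                            u ≢ w → u′ ≢ v → Adj G u u′
  loneNeighbours-adjacent {c} proper v-single w-single v≢w lone lone′ cu≢cu′ u≢w u′≢v =
    Adj-sym G (loneNeighbour-adjacent (swap-proper v-single lone proper)
      (swap-singleton v-single lone w-single v≢w u≢w) (swap-singleton-at-u v-single lone)
      (swap-loneNeighbour v-single lone lone′ cu≢cu′ u′≢v) (cu≢cu′ ∘′ cong c ∘′ sym))

module SingletonClasses {n} (G : Graph n) {k} (optimal : ∀ j → j < k → ¬ Colorable G j)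
                        {c : Fin n → Fin k} (proper : Proper G k c) where

  open Recolouring G
  open Optimal G optimal

  -- Phrased as in singletons, so that #singletons below is definitionally singletons G k c.
  SingletonColour : Fin k → Set
  SingletonColour i = classSize G (λ j v → ⌊ c v ≟ j ⌋) i ≡ 1

  singletonColour? : Decidable SingletonColour
  singletonColour? i = classSize G (λ j v → ⌊ c v ≟ j ⌋) i ℕ.≟ 1

  #singletons : ℕ
  #singletons = count singletonColour?

  singletonColour⇒singleton : ∀ {i} → SingletonColour i → ∃ λ x → c x ≡ i × Singleton c x
  singletonColour⇒singleton {i} size≡1 with filter (λ v → ⌊ c v ≟ i ⌋ Bool.≟ true) (allFin n) in class | size≡1
  ... | x ∷ [] | _ = x , cx≡i , x-single
    where
      hasColour : ∀ v → Dec (⌊ c v ≟ i ⌋ ≡ true)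
      hasColour v = ⌊ c v ≟ i ⌋ Bool.≟ true
      cx≡i : c x ≡ i
      cx≡i = toWitness (Equivalence.from T-≡
        (proj₂ (∈-filter⁻ hasColour {xs = allFin n} (subst (x ∈_) (sym class) (here refl)))))
      x-single : Singleton c x
      x-single y cy≡cx
        with subst (y ∈_) class (∈-filter⁺ hasColour (∈-allFin y)
               (Equivalence.to T-≡ (fromWitness (trans cy≡cx cx≡i))))
      ... | here y≡x = y≡x

  singletonVertex : Fin #singletons → Fin n
  singletonVertex a = proj₁ (singletonColour⇒singleton (enumerate-sound singletonColour? a))

  singletonVertex-colour : ∀ a → c (singletonVertex a) ≡ enumerate singletonColour? a
  singletonVertex-colour a = proj₁ (proj₂ (singletonColour⇒singleton (enumerate-sound singletonColour? a)))

  singletonVertex-singleton : ∀ a → Singleton c (singletonVertex a)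
  singletonVertex-singleton a = proj₂ (proj₂ (singletonColour⇒singleton (enumerate-sound singletonColour? a)))

  singletonColour-singletonVertex : ∀ a → SingletonColour (c (singletonVertex a))
  singletonColour-singletonVertex a =
    subst SingletonColour (sym (singletonVertex-colour a)) (enumerate-sound singletonColour? a)

  singletonVertex-injective : Injective _≡_ _≡_ singletonVertex
  singletonVertex-injective {a} {b} eq = enumerate-injective singletonColour?
    (trans (sym (singletonVertex-colour a)) (trans (cong c eq) (singletonVertex-colour b)))

  Repeated : Fin n → Fin k → Set
  Repeated v j = ∃ λ u → ∃ λ u′ → u ≢ u′ × (Adj G v u × c u ≡ j) × (Adj G v u′ × c u′ ≡ j)

  Light : Fin n → Fin k → Set
  Light v j = ¬ Repeated v j × ¬ SingletonColour j

  repeated? : ∀ v → Decidable (Repeated v)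
  repeated? v j = any? λ u → any? λ u′ →
    ¬? (u ≟ u′) ×-dec (Adj? G v u ×-dec c u ≟ j) ×-dec (Adj? G v u′ ×-dec c u′ ≟ j)

  light? : ∀ v → Decidable (Light v)
  light? v j = ¬? (repeated? v j) ×-dec ¬? (singletonColour? j)

  nonRepeated⇒loneNeighbour : ∀ {v j} → Singleton c v → j ≢ c v → ¬ Repeated v j →
                              ∃ λ u → LoneNeighbour c v u × c u ≡ j
  nonRepeated⇒loneNeighbour {v} {j} v-single j≢cv unrepeated
    with singleton-sees-every-colour proper v-single j j≢cv
  ... | u , vu , cu≡j = u , (vu , lone) , cu≡j
    where
      lone : ∀ w → Adj G v w → c w ≡ c u → w ≡ u
      lone w vw cw≡cu with w ≟ u
      ... | yes w≡u = w≡u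
      ... | no w≢u  = ⊥-elim (unrepeated (w , u , w≢u , (vw , trans cw≡cu cu≡j) , (vu , cu≡j)))

  module _ {v} (v-single : Singleton c v) where

    ClosedNeighbour : Fin n → Set
    ClosedNeighbour x = Adj G v x ⊎ x ≡ v

    closedNeighbour? : Decidable ClosedNeighbour
    closedNeighbour? x = Adj? G v x ⊎-dec x ≟ v

    firstRepresentative : ∀ j → ∃ λ x → c x ≡ j × ClosedNeighbour x
    firstRepresentative j with j ≟ c v
    ... | yes refl = v , refl , inj₂ refl
    ... | no j≢cv  with singleton-sees-every-colour proper v-single j j≢cv
    ...   | u , vu , cu≡j = u , cu≡j , inj₁ vu

    first : Fin k → Fin n
    first j = proj₁ (firstRepresentative j)

    secondRepresentative : ∀ i → let j = enumerate (repeated? v) i in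
                           ∃ λ x → c x ≡ j × Adj G v x × x ≢ first j
    secondRepresentative i with enumerate-sound (repeated? v) i
    ... | u , u′ , u≢u′ , (vu , cu≡j) , (vu′ , cu′≡j) with u ≟ first (enumerate (repeated? v) i)
    ...   | yes refl   = u′ , cu′≡j , vu′ , u≢u′ ∘′ sym
    ...   | no u≢first = u , cu≡j , vu , u≢first

    second : Fin (count (repeated? v)) → Fin n
    second i = proj₁ (secondRepresentative i)

    first-colour : ∀ j → c (first j) ≡ j
    first-colour j = proj₁ (proj₂ (firstRepresentative j))

    second-colour : ∀ i → c (second i) ≡ enumerate (repeated? v) i
    second-colour i = proj₁ (proj₂ (secondRepresentative i))

    second≢first : ∀ i → second i ≢ first (enumerate (repeated? v) i)
    second≢first i = proj₂ (proj₂ (proj₂ (secondRepresentative i)))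

    first≢second : ∀ j i → first j ≢ second i
    first≢second j i eq = second≢first i (trans (sym eq) (cong first same-colour))
      where
        same-colour : j ≡ enumerate (repeated? v) i
        same-colour = trans (sym (first-colour j)) (trans (cong c eq) (second-colour i))

    representatives-injective : Injective _≡_ _≡_ [ first , second ]′
    representatives-injective = [,]-injective
      (λ {j} {j′} eq → trans (sym (first-colour j)) (trans (cong c eq) (first-colour j′)))
      (λ {i} {i′} eq → enumerate-injective (repeated? v)
        (trans (sym (second-colour i)) (trans (cong c eq) (second-colour i′))))
      first≢second

    representatives-closed : ∀ p → ClosedNeighbour ([ first , second ]′ p)
    representatives-closed (inj₁ j) = proj₂ (proj₂ (firstRepresentative j))
    representatives-closed (inj₂ i) = inj₁ (proj₁ (proj₂ (proj₂ (secondRepresentative i))))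

    colours+repetitions≤degree+1 : k + count (repeated? v) ≤ degree G v + 1
    colours+repetitions≤degree+1 = ≤-trans
      (injection⇒≤count closedNeighbour? ([ first , second ]′ ∘ splitAt k)
        (Compose.injective _≡_ _≡_ _≡_ (splitAt-injective k) representatives-injective)
        (representatives-closed ∘ splitAt k))
      (≤-trans (count-⊎ closedNeighbour? (Adj? G v) (_≟ v) id)
        (+-monoʳ-≤ (degree G v) (cover⇒count≤ (_≟ v) (const v) (λ x≡v → zero , sym x≡v))))

  colours≤repeated+singleton+light : ∀ v → k ≤ count (repeated? v) + (#singletons + count (light? v))
  colours≤repeated+singleton+light v = begin
    k                                               ≤⟨ injection⇒≤count allColours? id id (const tt) ⟩
    count allColours?                                       ≤⟨ count-⊎ allColours? (repeated? v) (∁? (repeated? v))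
                                                         (λ {j} _ → toSum (repeated? v j)) ⟩
    count (repeated? v) + count (∁? (repeated? v))  ≤⟨ +-monoʳ-≤ _ (count-⊎ (∁? (repeated? v))
                                                         singletonColour? (light? v)
                                                         (λ {j} ¬rep → map₂ (¬rep ,_) (toSum (singletonColour? j)))) ⟩
    count (repeated? v) + (#singletons + count (light? v)) ∎
    where
      open ≤-Reasoning
      allColours? : Decidable {A = Fin k} U
      allColours? = U?

  fewLight⇒bound : ∀ {v ω} → Singleton c v → #singletons + count (light? v) ≤ ω →
                   2 * k ≤ ω + degree G v + 1
  fewLight⇒bound {v} {ω} v-single few = begin
    2 * k                    ≡⟨ cong (k +_) (+-identityʳ k) ⟩
    k + k                    ≤⟨ +-monoʳ-≤ k (≤-trans (colours≤repeated+singleton+light v) (+-monoʳ-≤ r few)) ⟩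
    k + (r + ω)              ≡⟨ +-assoc k r ω ⟨
    k + r + ω                ≤⟨ +-monoˡ-≤ ω (colours+repetitions≤degree+1 v-single) ⟩
    degree G v + 1 + ω       ≡⟨ +-comm (degree G v + 1) ω ⟩
    ω + (degree G v + 1)     ≡⟨ +-assoc ω (degree G v) 1 ⟨
    ω + degree G v + 1       ∎
    where
      open ≤-Reasoning
      r : ℕ
      r = count (repeated? v)

  nonSingletonColour⇒≢singletonVertex : ∀ {x} → ¬ SingletonColour (c x) → ∀ a → x ≢ singletonVertex a
  nonSingletonColour⇒≢singletonVertex notSingleton a refl = notSingleton (singletonColour-singletonVertex a)

  module LightClique {m} (m≤#s : m ≤ #singletons)
                     (large : ∀ a → m ≤ count (light? (singletonVertex a))) where

    centre : Fin m → Fin n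
    centre i = singletonVertex (inject≤ i m≤#s)

    centre-singleton : ∀ i → Singleton c (centre i)
    centre-singleton i = singletonVertex-singleton (inject≤ i m≤#s)

    centre-injective : Injective _≡_ _≡_ centre
    centre-injective {i} {j} = inject≤-injective m≤#s m≤#s i j ∘ singletonVertex-injective

    lightColours : ∃ λ σ → Injective _≡_ _≡_ σ × (∀ i → Light (centre i) (σ i))
    lightColours = distinctRepresentatives m (Light ∘ centre) (light? ∘ centre) (large ∘ (λ i → inject≤ i m≤#s))

    lightColour : Fin m → Fin k
    lightColour = proj₁ lightColours

    lightColour-light : ∀ i → Light (centre i) (lightColour i)
    lightColour-light = proj₂ (proj₂ lightColours)

    partnerSpec : ∀ i → ∃ λ u → LoneNeighbour c (centre i) u × c u ≡ lightColour i
    partnerSpec i = nonRepeated⇒loneNeighbour (centre-singleton i)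
      (λ σ≡c → nonSingletonColour⇒≢singletonVertex
                 (subst (¬_ ∘ SingletonColour) σ≡c (proj₂ (lightColour-light i))) _ refl)
      (proj₁ (lightColour-light i))

    partner : Fin m → Fin n
    partner i = proj₁ (partnerSpec i)

    partner-lone : ∀ i → LoneNeighbour c (centre i) (partner i)
    partner-lone i = proj₁ (proj₂ (partnerSpec i))

    partner-colour : ∀ i → c (partner i) ≡ lightColour i
    partner-colour i = proj₂ (proj₂ (partnerSpec i))

    partner≢singletonVertex : ∀ i a → partner i ≢ singletonVertex a
    partner≢singletonVertex i = nonSingletonColour⇒≢singletonVertex
      (subst (¬_ ∘ SingletonColour) (sym (partner-colour i)) (proj₂ (lightColour-light i)))

    partner-colours-distinct : ∀ {i j} → i ≢ j → c (partner i) ≢ c (partner j)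
    partner-colours-distinct i≢j eq =
      i≢j (proj₁ (proj₂ lightColours) (trans (sym (partner-colour _)) (trans eq (partner-colour _))))

    member : Fin #singletons ⊎ Fin m → Fin n
    member = [ singletonVertex , partner ]′

    members-adjacent : ∀ p q → p ≢ q → Adj G (member p) (member q)
    members-adjacent (inj₁ a) (inj₁ b) a≢b = singletons-adjacent proper
      (singletonVertex-singleton a) (singletonVertex-singleton b) (a≢b ∘ cong inj₁ ∘ singletonVertex-injective)
    members-adjacent (inj₁ a) (inj₂ i) _ = Adj-sym G (loneNeighbour-adjacent proper
      (centre-singleton i) (singletonVertex-singleton a) (partner-lone i) (partner≢singletonVertex i a))
    members-adjacent (inj₂ i) (inj₁ a) _ = loneNeighbour-adjacent proper
      (centre-singleton i) (singletonVertex-singleton a) (partner-lone i) (partner≢singletonVertex i a)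
    members-adjacent (inj₂ i) (inj₂ j) i≢j = loneNeighbours-adjacent proper
      (centre-singleton i) (centre-singleton j) (i≢j ∘ cong inj₂ ∘ centre-injective)
      (partner-lone i) (partner-lone j) (partner-colours-distinct (i≢j ∘ cong inj₂))
      (partner≢singletonVertex i _) (partner≢singletonVertex j _)

  manyLight⇒clique : ∀ {m} → m ≤ #singletons → (∀ a → m ≤ count (light? (singletonVertex a))) →
                     HasClique G (#singletons + m)
  manyLight⇒clique m≤#s large = pairwiseAdjacent⇒clique G (member ∘ splitAt #singletons)
    (λ i j i≢j → members-adjacent (splitAt _ i) (splitAt _ j) (i≢j ∘ splitAt-injective _))
    where open LightClique m≤#s large

  2χ≤ω+Δ+1 : ∀ {ω} → (∀ w → HasClique G w → w ≤ ω) → ω < 2 * #singletons → 2 * k ≤ ω + maxDegree G + 1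
  2χ≤ω+Δ+1 {ω} maximal ω<2s with any? (λ a → #singletons + count (light? (singletonVertex a)) ≤? ω)
  ... | yes (a , few) = ≤-trans (fewLight⇒bound (singletonVertex-singleton a) few)
                          (+-monoˡ-≤ 1 (+-monoʳ-≤ ω (degree≤maxDegree G (singletonVertex a))))
  ... | no none = ⊥-elim (<⇒≱ (m≤n+m∸n (suc ω) #singletons) (maximal _ (manyLight⇒clique m≤#s large)))
    where
      m≤#s : suc ω ∸ #singletons ≤ #singletons
      m≤#s = m≤n+o⇒m∸n≤o (suc ω) #singletons (subst (suc ω ≤_) (cong (#singletons +_) (+-identityʳ _)) ω<2s)
      large : ∀ a → suc ω ∸ #singletons ≤ count (light? (singletonVertex a))
      large a = m≤n+o⇒m∸n≤o (suc ω) #singletons (≰⇒> (λ few → none (a , few)))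

lemma2p2 : (n : ℕ) (G : Graph n) (χ ω ι : ℕ) →
    IsChromaticNumber G χ → IsCliqueNumber G ω → IsStinginess G ι →
    ω < 2 * ι →
    2 * χ ≤ ω + maxDegree G + 1
lemma2p2 n G χ ω ι chromatic (_ , maximal) (χ′ , chromatic′ , (c , proper , refl) , _) ω<2ι
  rewrite chromaticNumber-unique G chromatic chromatic′ =
  SingletonClasses.2χ≤ω+Δ+1 G (proj₂ chromatic′) proper maximal ω<2ι
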